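{- Let $\mathbf{x}=(x_1,\dots,x_d)$ and $p_1,\dots,p_k\in\mathbb{NPE}[\mathbf{x}]$. Then validity of $\exists\mathbf{c}\in\mathbb{Z}^d,\ n_0\in\mathbb{N}.\ \forall n\in\mathbb{N}_{>n_0}.\ \bigwedge_{i=1}^{k}p_i[\mathbf{x}/\mathbf{c}]>0$ is decidable.
   Context: $n$ is a designated variable over $\mathbb{N}$. $\mathbb{NPE}[\mathbf{x}]$ is the set of expressions $\sum_{j=1}^{\ell}\alpha_j\cdot n^{a_j}\cdot b_j^n$ with $\ell,a_j\in\mathbb{N}$, $b_j\in\mathbb{N}_{\ge1}$, and each $\alpha_j$ an affine expression $\mathbf{v}^T\mathbf{x}+v$ with $\mathbf{v}\in\mathbb{Q}^d$, $v\in\mathbb{Q}$ (the given expressions are given explicitly, with rational coefficients). -}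

module Defs where

open import Data.Nat as ℕ using (ℕ; _≥_)
open import Data.Integer as ℤ using (ℤ)
open import Data.Rational using (ℚ; 0ℚ; _+_; _*_; _/_)
open import Data.Fin using (Fin; zero; suc)
open import Data.List using (List; []; _∷_)
open import Data.Vec using (Vec; lookup)

ℤ→ℚ : ℤ → ℚ
ℤ→ℚ z = z / 1

ℕ→ℚ : ℕ → ℚ
ℕ→ℚ m = ℤ.+ m / 1

record Affine (d : ℕ) : Set where
  constructor affine
  field
    coeffs   : Fin d → ℚ
    constant : ℚ

sumFin : (d : ℕ) → (Fin d → ℚ) → ℚ
sumFin ℕ.zero    f = 0ℚ
sumFin (ℕ.suc d) f = f zero + sumFin d (λ i → f (suc i))

evalAffine : {d : ℕ} → Affine d → (Fin d → ℤ) → ℚ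
evalAffine {d} (affine v v₀) c = sumFin d (λ i → v i * ℤ→ℚ (c i)) + v₀

-- One summand  α · n^a · b^n  with a ∈ ℕ and b ∈ ℕ_{≥1}.
record NPETerm (d : ℕ) : Set where
  constructor npeTerm
  field
    α     : Affine d
    a     : ℕ
    b     : ℕ
    b≥1   : b ≥ 1

NPE : ℕ → Set
NPE d = List (NPETerm d)

evalNPE : {d : ℕ} → NPE d → (Fin d → ℤ) → ℕ → ℚ
evalNPE []                         c n = 0ℚ
evalNPE (npeTerm α a b _ ∷ p) c n =
  evalAffine α c * ℕ→ℚ (n ℕ.^ a) * ℕ→ℚ (b ℕ.^ n) + evalNPE p c n

module Submission where

-- Clearing denominators (which preserves signs) writes pᵢ[x/c](n) as Σⱼ Lⱼ(c) · n^{aⱼ} · bⱼⁿ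
-- with integer affine forms Lⱼ.  After merging equal monomials and sorting them by growth
-- (lexicographically in (bⱼ, aⱼ)), every monomial is negligible against the ones before it, so
-- pᵢ[x/c] is eventually positive iff its first nonzero coefficient Lⱼ(c) is positive.  This is a
-- quantifier-free Presburger condition on c, hence the theorem reduces to the satisfiability of an
-- existential Presburger formula in DNF, decided by Cooper-style elimination of one variable at
-- a time.

open import Defs
open import Data.Nat using (ℕ; _>_)
open import Data.Integer using (ℤ)
open import Data.Rational using (0ℚ) renaming (_<_ to _<ℚ_)
open import Data.Fin using (Fin)
open import Data.Product using (∃; ∃-syntax)
open import Relation.Nullary using (Dec)

import Data.Nat as Nat
import Data.Nat.Properties as ℕP
import Data.Integer as Int
import Data.Integer.Properties as ℤP
open import Data.Rational using (ℚ)
open import Data.Fin using (zero; suc)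
open import Data.Vec.Functional using (Vector; head; tail) renaming (_∷_ to _∷ᵥ_)
open import Data.Product using (_×_; _,_; proj₁; proj₂)
open import Data.Sum using (_⊎_; inj₁; inj₂)
open import Function using (_∘_; _⇔_; mk⇔; Equivalence)
open import Relation.Binary.PropositionalEquality
open import Data.Unit using (⊤; tt)
open import Data.Empty using (⊥-elim)
open import Data.List using (List; []; _∷_; _++_; map; concatMap; applyUpTo; cartesianProductWith)
open import Data.List.Relation.Unary.All as All using (All; []; _∷_)
open import Data.List.Relation.Unary.Any as Any using (Any; here; there)
import Data.List.Relation.Unary.All.Properties as Allₚ
import Data.List.Relation.Unary.Any.Properties as Anyₚ
import Function.Properties.Equivalence as ⇔
open import Relation.Nullary using (yes; no; ¬_)
import Relation.Nullary.Decidable as Dec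

private
  variable
    d : ℕ

module IntegerForms where

  open import Data.Integer.Tactic.RingSolver using (solve-∀)
  open Int using (+_; _+_; _*_; -_)
  open import Algebra.Properties.Semiring.Sum ℤP.+-*-semiring
    using (sum; ∑-distrib-+; *-distribˡ-sum; sum-cong-≗)

  record Form (d : ℕ) : Set where
    constructor form
    field
      coeff  : Vector ℤ d
      offset : ℤ

  eval : Form d → Vector ℤ d → ℤ
  eval (form w w₀) c = sum (λ i → w i * c i) + w₀

  infixl 6 _⊕_
  infixr 7 _⊛_
  infixr 5 _◂_

  _⊕_ : Form d → Form d → Form d
  form w w₀ ⊕ form v v₀ = form (λ i → w i + v i) (w₀ + v₀)

  _⊛_ : ℤ → Form d → Form d
  k ⊛ form w w₀ = form (λ i → k * w i) (k * w₀)

  constant : ℤ → Form d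
  constant k = form (λ _ → + 0) k

  lead : Form (Nat.suc d) → ℤ
  lead (form w _) = head w

  rest : Form (Nat.suc d) → Form d
  rest (form w w₀) = form (tail w) w₀

  _◂_ : ℤ → Form d → Form (Nat.suc d)
  a ◂ form w w₀ = form (a ∷ᵥ w) w₀

  eval-⊕ : (L M : Form d) (c : Vector ℤ d) → eval (L ⊕ M) c ≡ eval L c + eval M c
  eval-⊕ (form w w₀) (form v v₀) c = begin
    sum (λ i → (w i + v i) * c i) + (w₀ + v₀)
      ≡⟨ cong (_+ (w₀ + v₀)) (trans (sum-cong-≗ (λ i → ℤP.*-distribʳ-+ (c i) (w i) (v i)))
                                    (∑-distrib-+ (λ i → w i * c i) (λ i → v i * c i))) ⟩
    (sum (λ i → w i * c i) + sum (λ i → v i * c i)) + (w₀ + v₀)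
      ≡⟨ interchange (sum (λ i → w i * c i)) (sum (λ i → v i * c i)) w₀ v₀ ⟩
    (sum (λ i → w i * c i) + w₀) + (sum (λ i → v i * c i) + v₀) ∎
    where
    open ≡-Reasoning
    interchange : ∀ a b x y → (a + b) + (x + y) ≡ (a + x) + (b + y)
    interchange = solve-∀

  eval-⊛ : (k : ℤ) (L : Form d) (c : Vector ℤ d) → eval (k ⊛ L) c ≡ k * eval L c
  eval-⊛ k (form w w₀) c = begin
    sum (λ i → k * w i * c i) + k * w₀
      ≡⟨ cong (_+ k * w₀) (trans (sum-cong-≗ (λ i → ℤP.*-assoc k (w i) (c i)))
                                 (sym (*-distribˡ-sum k (λ i → w i * c i)))) ⟩
    k * sum (λ i → w i * c i) + k * w₀
      ≡⟨ sym (ℤP.*-distribˡ-+ k _ w₀) ⟩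
    k * (sum (λ i → w i * c i) + w₀) ∎
    where open ≡-Reasoning

  eval-constant : (k : ℤ) (c : Vector ℤ d) → eval (constant k) c ≡ k
  eval-constant k c = begin
    sum (λ i → + 0 * c i) + k  ≡⟨ cong (_+ k) (sym (*-distribˡ-sum (+ 0) c)) ⟩
    + 0 * sum c + k            ≡⟨ ℤP.+-identityˡ k ⟩
    k                          ∎
    where open ≡-Reasoning

  eval-∷ : (L : Form (Nat.suc d)) (x : ℤ) (c : Vector ℤ d) →
           eval L (x ∷ᵥ c) ≡ lead L * x + eval (rest L) c
  eval-∷ (form w w₀) x c = ℤP.+-assoc (head w * x) (sum (λ i → tail w i * c i)) w₀

  eval-cong : (L : Form d) {c c′ : Vector ℤ d} → (∀ i → c i ≡ c′ i) → eval L c ≡ eval L c′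
  eval-cong (form w w₀) c≗c′ = cong (_+ w₀) (sum-cong-≗ (λ i → cong (w _ *_) (c≗c′ i)))

module Formulas where

  open IntegerForms
  open Int using (+_; +[1+_]; _≤_)
  open import Data.Integer.Divisibility.Signed using (_∣_; _∣?_)

  -- Atomic constraints: a form is non-negative, or divisible by the positive modulus 1 + m.
  data Atom (d : ℕ) : Set where
    nonneg   : Form d → Atom d
    multiple : ℕ → Form d → Atom d

  Holds : Atom d → Vector ℤ d → Set
  Holds (nonneg L)    c = + 0 ≤ eval L c
  Holds (multiple m L) c = +[1+ m ] ∣ eval L c

  Conj : ℕ → Set
  Conj d = List (Atom d)

  DNF : ℕ → Set
  DNF d = List (Conj d)

  SatConj : Conj d → Vector ℤ d → Set
  SatConj C c = All (λ A → Holds A c) C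

  Sat : DNF d → Vector ℤ d → Set
  Sat φ c = Any (λ C → SatConj C c) φ

  holds? : (A : Atom d) (c : Vector ℤ d) → Dec (Holds A c)
  holds? (nonneg L)    c = + 0 Int.≤? eval L c
  holds? (multiple m L) c = +[1+ m ] ∣? eval L c

  satConj? : (C : Conj d) (c : Vector ℤ d) → Dec (SatConj C c)
  satConj? C c = All.all? (λ A → holds? A c) C

  sat? : (φ : DNF d) (c : Vector ℤ d) → Dec (Sat φ c)
  sat? φ c = Any.any? (λ C → satConj? C c) φ

  holds-cong : (A : Atom d) {c c′ : Vector ℤ d} → (∀ i → c i ≡ c′ i) → Holds A c → Holds A c′
  holds-cong (nonneg L)    c≗c′ h = subst (+ 0 ≤_) (eval-cong L c≗c′) h
  holds-cong (multiple m L) c≗c′ h = subst (+[1+ m ] ∣_) (eval-cong L c≗c′) h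

  sat-cong : (φ : DNF d) {c c′ : Vector ℤ d} → (∀ i → c i ≡ c′ i) → Sat φ c → Sat φ c′
  sat-cong φ c≗c′ = Any.map (All.map (λ {A} → holds-cong A c≗c′))

  mapAtom : ∀ {d′} → (Form d → Form d′) → Atom d → Atom d′
  mapAtom f (nonneg L)     = nonneg (f L)
  mapAtom f (multiple m L) = multiple m (f L)

  holds-mapAtom : ∀ {d′} (f : Form d → Form d′) (A : Atom d) {c : Vector ℤ d} {c′ : Vector ℤ d′} →
                  (∀ L → eval (f L) c′ ≡ eval L c) → Holds (mapAtom f A) c′ ⇔ Holds A c
  holds-mapAtom f (nonneg L)     same = subst (λ v → (+ 0 ≤ v) ⇔ _) (sym (same L)) ⇔.refl
  holds-mapAtom f (multiple m L) same = subst (λ v → (+[1+ m ] ∣ v) ⇔ _) (sym (same L)) ⇔.refl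

  _∧_ : DNF d → DNF d → DNF d
  φ ∧ ψ = cartesianProductWith _++_ φ ψ

  ∧-intro : (φ ψ : DNF d) {c : Vector ℤ d} → Sat φ c → Sat ψ c → Sat (φ ∧ ψ) c
  ∧-intro φ ψ = Anyₚ.cartesianProductWith⁺ _++_ Allₚ.++⁺

  ∧-elim : (φ ψ : DNF d) {c : Vector ℤ d} → Sat (φ ∧ ψ) c → Sat φ c × Sat ψ c
  ∧-elim φ ψ = Anyₚ.cartesianProductWith⁻ _++_ (Allₚ.++⁻ _) φ ψ

  ⋀ : (k : ℕ) → (Fin k → DNF d) → DNF d
  ⋀ Nat.zero    φ = [] ∷ []
  ⋀ (Nat.suc k) φ = φ zero ∧ ⋀ k (φ ∘ suc)

  ⋀-intro : (k : ℕ) (φ : Fin k → DNF d) {c : Vector ℤ d} → (∀ i → Sat (φ i) c) → Sat (⋀ k φ) c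
  ⋀-intro Nat.zero    φ h = here []
  ⋀-intro (Nat.suc k) φ h = ∧-intro (φ zero) (⋀ k (φ ∘ suc)) (h zero) (⋀-intro k (φ ∘ suc) (h ∘ suc))

  ⋀-elim : (k : ℕ) (φ : Fin k → DNF d) {c : Vector ℤ d} → Sat (⋀ k φ) c → ∀ i → Sat (φ i) c
  ⋀-elim (Nat.suc k) φ h zero    = proj₁ (∧-elim (φ zero) (⋀ k (φ ∘ suc)) h)
  ⋀-elim (Nat.suc k) φ h (suc i) = ⋀-elim k (φ ∘ suc) (proj₂ (∧-elim (φ zero) (⋀ k (φ ∘ suc)) h)) i

switch-off : (P : ℕ → Set) → (∀ q → Dec (P q)) → P 0 → ∀ B → ¬ P B → ∃[ q ] P q × ¬ P (Nat.suc q)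
switch-off P P? p₀ Nat.zero    ¬p = ⊥-elim (¬p p₀)
switch-off P P? p₀ (Nat.suc B) ¬p with P? B
... | yes p  = B , p , ¬p
... | no ¬p′ = switch-off P P? p₀ B ¬p′

all∩any : ∀ {A : Set} {P Q : A → Set} {xs : List A} → All P xs → Any Q xs → Any (λ x → P x × Q x) xs
all∩any (p ∷ _)  (here q)   = here (p , q)
all∩any (_ ∷ ps) (there qs) = there (all∩any ps qs)

-- Elimination of one existentially quantified variable x₀ (Cooper's method).
--
-- Let C be a conjunction containing the bound 0 ≤ x₀ (negative values of x₀ are handled by
-- replacing x₀ with −x₀), and let δ be the product of its moduli.  Divisibility atoms are
-- δ-periodic in x₀, so if C holds at some x₀ = y, walking down from y in steps of δ reaches a
-- solution y with C false at y − δ.  The atom failing there is a lower bound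
-- 0 ≤ (1+a)·x₀ + R  with  0 ≤ (1+a)·y + R < (1+a)·δ,  so  (1+a)·y = r − R  for a residue
-- r < (1+a)·δ.  Substituting r − R for (1+a)·x₀ yields finitely many x₀-free candidate
-- conjunctions, one of which holds.
module Elimination where

  open import Data.Integer.Tactic.RingSolver using (solve-∀)
  open IntegerForms
  open Formulas
  open Int using (+_; +[1+_]; -[1+_]; _+_; _*_; -_; _-_; _≤_; +≤+; ∣_∣)
  open import Data.Integer.Divisibility.Signed
    using (_∣_; divides; ∣ᵤ⇒∣; ∣m∣n⇒∣m-n; ∣n⇒∣m*n; *-monoʳ-∣; *-cancelˡ-∣)
  import Data.Nat.Divisibility as ℕD
  open ≡-Reasoning

  eval-shift : (L : Form (Nat.suc d)) (y D : ℤ) (c : Vector ℤ d) →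
               eval L ((y - D) ∷ᵥ c) ≡ eval L (y ∷ᵥ c) - lead L * D
  eval-shift L y D c = begin
    eval L ((y - D) ∷ᵥ c)               ≡⟨ eval-∷ L (y - D) c ⟩
    lead L * (y - D) + eval (rest L) c  ≡⟨ distribute (lead L) y D (eval (rest L) c) ⟩
    (lead L * y + eval (rest L) c) - lead L * D  ≡⟨ cong (_- lead L * D) (sym (eval-∷ L y c)) ⟩
    eval L (y ∷ᵥ c) - lead L * D        ∎
    where
    distribute : ∀ h y D s → h * (y - D) + s ≡ (h * y + s) - h * D
    distribute = solve-∀

  period : Conj d → ℕ
  period []                = 1
  period (nonneg _ ∷ C)    = period C
  period (multiple m _ ∷ C) = Nat.suc m Nat.* period C

  -- Periods are positive, so descending in steps of the period eventually leaves ℕ.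
  period-pos : (C : Conj d) → 1 Nat.≤ period C
  period-pos []                 = Nat.s≤s Nat.z≤n
  period-pos (nonneg _ ∷ C)     = period-pos C
  period-pos (multiple m _ ∷ C) = ℕP.≤-trans (period-pos C) (ℕP.m≤m+n (period C) _)

  ModulusDivides : ℕ → Atom d → Set
  ModulusDivides D (nonneg _)     = ⊤
  ModulusDivides D (multiple m _) = Nat.suc m ℕD.∣ D

  period-divisible : (C : Conj d) → All (ModulusDivides (period C)) C
  period-divisible []                 = []
  period-divisible (nonneg _ ∷ C)     = tt ∷ period-divisible C
  period-divisible (multiple m _ ∷ C) =
    ℕD.m∣m*n (period C) ∷ All.map (λ {A} → widen A) (period-divisible C)
    where
    widen : (A : Atom _) → ModulusDivides (period C) A → ModulusDivides (Nat.suc m Nat.* period C) A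
    widen (nonneg _)     _   = tt
    widen (multiple _ _) m∣δ = ℕD.∣-trans m∣δ (ℕD.n∣m*n (Nat.suc m))

  multiple-shift : ∀ m (L : Form (Nat.suc d)) y (D : ℕ) (c : Vector ℤ d) → Nat.suc m ℕD.∣ D →
                   Holds (multiple m L) (y ∷ᵥ c) → Holds (multiple m L) ((y - + D) ∷ᵥ c)
  multiple-shift m L y D c m∣D h =
    subst (+[1+ m ] ∣_) (sym (eval-shift L y (+ D) c)) (∣m∣n⇒∣m-n h (∣n⇒∣m*n (lead L) (∣ᵤ⇒∣ m∣D)))

  -- Given  (1+a)·x₀ = e,  the form (1+a)·L written without x₀.
  substForm : ℕ → Form d → Form (Nat.suc d) → Form d
  substForm a e L = lead L ⊛ e ⊕ +[1+ a ] ⊛ rest L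

  eval-substForm : ∀ a (e : Form d) L x c → +[1+ a ] * x ≡ eval e c →
                   eval (substForm a e L) c ≡ +[1+ a ] * eval L (x ∷ᵥ c)
  eval-substForm a e L x c ax≡e = begin
    eval (lead L ⊛ e ⊕ +[1+ a ] ⊛ rest L) c
      ≡⟨ eval-⊕ (lead L ⊛ e) (+[1+ a ] ⊛ rest L) c ⟩
    eval (lead L ⊛ e) c + eval (+[1+ a ] ⊛ rest L) c
      ≡⟨ cong₂ _+_ (eval-⊛ (lead L) e c) (eval-⊛ +[1+ a ] (rest L) c) ⟩
    lead L * eval e c + +[1+ a ] * eval (rest L) c
      ≡⟨ cong (λ v → lead L * v + +[1+ a ] * eval (rest L) c) (sym ax≡e) ⟩
    lead L * (+[1+ a ] * x) + +[1+ a ] * eval (rest L) c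
      ≡⟨ factor (lead L) +[1+ a ] x (eval (rest L) c) ⟩
    +[1+ a ] * (lead L * x + eval (rest L) c)
      ≡⟨ cong (+[1+ a ] *_) (sym (eval-∷ L x c)) ⟩
    +[1+ a ] * eval L (x ∷ᵥ c) ∎
    where
    factor : ∀ h A x s → h * (A * x) + A * s ≡ A * (h * x + s)
    factor = solve-∀

  scale-nonneg : ∀ a v → + 0 ≤ v ⇔ + 0 ≤ +[1+ a ] * v
  scale-nonneg a (+ n)     = mk⇔ (λ _ → subst (+ 0 ≤_) (ℤP.pos-* (Nat.suc a) n) (+≤+ Nat.z≤n))
                                 (λ _ → +≤+ Nat.z≤n)
  scale-nonneg a -[1+ n ] = mk⇔ (λ ()) (λ ())

  scale-multiple : ∀ a m v → (+[1+ m ] ∣ v) ⇔ (+[1+ a ] * +[1+ m ] ∣ +[1+ a ] * v)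
  scale-multiple a m v = mk⇔ (*-monoʳ-∣ +[1+ a ]) (*-cancelˡ-∣ +[1+ a ])

  -- Substitution of e for (1+a)·x₀ in an atom; a modulus 1+m becomes (1+a)(1+m).
  substAtom : ℕ → Form d → Atom (Nat.suc d) → Atom d
  substAtom a e (nonneg L)     = nonneg (substForm a e L)
  substAtom a e (multiple m L) = multiple (m Nat.+ a Nat.* Nat.suc m) (substForm a e L)

  substAtom-correct : ∀ a (e : Form d) A x c → +[1+ a ] * x ≡ eval e c →
                      Holds (substAtom a e A) c ⇔ Holds A (x ∷ᵥ c)
  substAtom-correct a e (nonneg L) x c ax≡e =
    subst (λ v → (+ 0 ≤ v) ⇔ _) (sym (eval-substForm a e L x c ax≡e)) (⇔.sym (scale-nonneg a _))
  substAtom-correct a e (multiple m L) x c ax≡e =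
    subst (λ v → (_ ∣ v) ⇔ _) (sym (eval-substForm a e L x c ax≡e)) (⇔.sym (scale-multiple a m _))

  candidate : Conj (Nat.suc d) → ℕ → Form d → Conj d
  candidate C a e = multiple a e ∷ map (substAtom a e) C

  candidate-sound : ∀ C a (e : Form d) c → SatConj (candidate C a e) c → ∃[ x ] SatConj C (x ∷ᵥ c)
  candidate-sound C a e c (divides x e≡x*A ∷ hs) =
    x , All.map (λ {A} → Equivalence.to (substAtom-correct a e A x c ax≡e)) (Allₚ.map⁻ hs)
    where
    ax≡e : +[1+ a ] * x ≡ eval e c
    ax≡e = trans (ℤP.*-comm +[1+ a ] x) (sym e≡x*A)

  candidate-complete : ∀ C a (e : Form d) x c → +[1+ a ] * x ≡ eval e c →
                       SatConj C (x ∷ᵥ c) → SatConj (candidate C a e) c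
  candidate-complete C a e x c ax≡e hs =
    divides x (trans (sym ax≡e) (ℤP.*-comm +[1+ a ] x)) ∷
    Allₚ.map⁺ (All.map (λ {A} → Equivalence.from (substAtom-correct a e A x c ax≡e)) hs)

  residual : ℕ → Form (Nat.suc d) → Form d
  residual r L = constant (+ r) ⊕ Int.-1ℤ ⊛ rest L

  eval-residual : ∀ r (L : Form (Nat.suc d)) c → eval (residual r L) c ≡ + r - eval (rest L) c
  eval-residual r L c = begin
    eval (constant (+ r) ⊕ Int.-1ℤ ⊛ rest L) c
      ≡⟨ eval-⊕ (constant (+ r)) (Int.-1ℤ ⊛ rest L) c ⟩
    eval (constant (+ r)) c + eval (Int.-1ℤ ⊛ rest L) c
      ≡⟨ cong₂ _+_ (eval-constant (+ r) c) (trans (eval-⊛ Int.-1ℤ (rest L) c) (ℤP.-1*i≡-i _)) ⟩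
    + r - eval (rest L) c ∎

  boundCandidates : Conj (Nat.suc d) → ℤ → Form (Nat.suc d) → DNF d
  boundCandidates C +[1+ a ] L = applyUpTo (λ r → candidate C a (residual r L)) (Nat.suc a Nat.* period C)
  boundCandidates C _        L = []

  atomCandidates : Conj (Nat.suc d) → Atom (Nat.suc d) → DNF d
  atomCandidates C (nonneg L)     = boundCandidates C (lead L) L
  atomCandidates C (multiple _ _) = []

  -- An x₀-free DNF equivalent to  ∃x₀. C  whenever C contains 0 ≤ x₀.
  eliminate : Conj (Nat.suc d) → DNF d
  eliminate C = concatMap (atomCandidates C) C

  eliminate-sound : ∀ (C : Conj (Nat.suc d)) c → Sat (eliminate C) c → ∃[ x ] SatConj C (x ∷ᵥ c)
  eliminate-sound C c h with Any.satisfied (Anyₚ.concatMap⁻ (atomCandidates C) {xs = C} h)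
  ... | nonneg L , h′ = bound-sound (lead L) h′
    where
    bound-sound : ∀ z → Sat (boundCandidates C z L) c → ∃[ x ] SatConj C (x ∷ᵥ c)
    bound-sound +[1+ a ] h″ with Anyₚ.applyUpTo⁻ _ h″
    ... | r , _ , hr = candidate-sound C a (residual r L) c hr

  bound-crossing : ∀ C (L : Form (Nat.suc d)) z → lead L ≡ z → ∀ c y → SatConj C (y ∷ᵥ c) →
                   + 0 ≤ eval L (y ∷ᵥ c) → ¬ (+ 0 ≤ eval L ((y - + period C) ∷ᵥ c)) →
                   Sat (boundCandidates C z L) c
  bound-crossing C L (+ 0) lead≡0 c y _ h ¬h′ = ⊥-elim (¬h′ (subst (+ 0 ≤_) (sym unchanged) h))
    where
    unchanged : eval L ((y - + period C) ∷ᵥ c) ≡ eval L (y ∷ᵥ c)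
    unchanged = begin
      eval L ((y - + period C) ∷ᵥ c)              ≡⟨ eval-shift L y (+ period C) c ⟩
      eval L (y ∷ᵥ c) - lead L * + period C       ≡⟨ cong (λ h → eval L (y ∷ᵥ c) - h * + period C) lead≡0 ⟩
      eval L (y ∷ᵥ c) - + 0                       ≡⟨ ℤP.+-identityʳ _ ⟩
      eval L (y ∷ᵥ c) ∎
  bound-crossing C L -[1+ j ] lead≡z c y _ h ¬h′ =
    ⊥-elim (¬h′ (subst (+ 0 ≤_) (sym increased) (ℤP.≤-trans h (ℤP.i≤i+j v (+ (Nat.suc j Nat.* period C))))))
    where
    v = eval L (y ∷ᵥ c)
    increased : eval L ((y - + period C) ∷ᵥ c) ≡ v + + (Nat.suc j Nat.* period C)
    increased = begin
      eval L ((y - + period C) ∷ᵥ c)  ≡⟨ eval-shift L y (+ period C) c ⟩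
      v - lead L * + period C         ≡⟨ cong (λ h → v - h * + period C) lead≡z ⟩
      v - -[1+ j ] * + period C       ≡⟨ cong (λ u → v + u) (ℤP.neg-distribˡ-* -[1+ j ] (+ period C)) ⟩
      v + +[1+ j ] * + period C       ≡⟨ cong (λ u → v + u) (sym (ℤP.pos-* (Nat.suc j) (period C))) ⟩
      v + + (Nat.suc j Nat.* period C) ∎
  bound-crossing C L +[1+ a ] lead≡z c y hC h ¬h′ =
    Anyₚ.applyUpTo⁺ (λ r → candidate C a (residual r L)) (candidate-complete C a (residual r L) y c ay≡e hC) r<N
    where
    δ = period C
    v = eval L (y ∷ᵥ c)
    r = ∣ v ∣
    r≡v : + r ≡ v
    r≡v = ℤP.0≤i⇒+∣i∣≡i h
    shifted : eval L ((y - + δ) ∷ᵥ c) ≡ v - + (Nat.suc a Nat.* δ)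
    shifted = begin
      eval L ((y - + δ) ∷ᵥ c)    ≡⟨ eval-shift L y (+ δ) c ⟩
      v - lead L * + δ           ≡⟨ cong (λ h → v - h * + δ) lead≡z ⟩
      v - +[1+ a ] * + δ         ≡⟨ cong (λ k → v - k) (sym (ℤP.pos-* (Nat.suc a) δ)) ⟩
      v - + (Nat.suc a Nat.* δ)  ∎
    r<N : r Nat.< Nat.suc a Nat.* δ
    r<N = ℕP.≰⇒> λ N≤r → ¬h′ (subst (+ 0 ≤_) (sym shifted)
                                (ℤP.i≤j⇒0≤j-i (subst (_ ≤_) r≡v (+≤+ N≤r))))
    ay≡e : +[1+ a ] * y ≡ eval (residual r L) c
    ay≡e = sym (begin
      eval (residual r L) c               ≡⟨ eval-residual r L c ⟩
      + r - eval (rest L) c               ≡⟨ cong (λ u → u - eval (rest L) c) (trans r≡v (eval-∷ L y c)) ⟩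
      lead L * y + eval (rest L) c - eval (rest L) c ≡⟨ cancel (lead L * y) (eval (rest L) c) ⟩
      lead L * y                          ≡⟨ cong (_* y) lead≡z ⟩
      +[1+ a ] * y                        ∎)
      where
      cancel : ∀ u s → u + s - s ≡ u
      cancel = solve-∀

  eliminate-crossing : ∀ (C : Conj (Nat.suc d)) c y → SatConj C (y ∷ᵥ c) →
                       ¬ SatConj C ((y - + period C) ∷ᵥ c) → Sat (eliminate C) c
  eliminate-crossing C c y hC ¬hC′ =
    Anyₚ.concatMap⁺ (atomCandidates C) (Any.map (λ {A} → crossing A) failing)
    where
    failing : Any (λ A → (ModulusDivides (period C) A × Holds A (y ∷ᵥ c)) × ¬ Holds A ((y - + period C) ∷ᵥ c)) C
    failing = all∩any (All.zip (period-divisible C , hC)) (Allₚ.¬All⇒Any¬ (λ A → holds? A _) C ¬hC′)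
    crossing : ∀ A → (ModulusDivides (period C) A × Holds A (y ∷ᵥ c)) × ¬ Holds A ((y - + period C) ∷ᵥ c) →
               Sat (atomCandidates C A) c
    crossing (nonneg L)     ((_ , h) , ¬h′)   = bound-crossing C L (lead L) refl c y hC h ¬h′
    crossing (multiple m L) ((m∣δ , h) , ¬h′) = ⊥-elim (¬h′ (multiple-shift m L y (period C) c m∣δ h))

  x₀-nonneg : Atom (Nat.suc d)
  x₀-nonneg = nonneg (+ 1 ◂ constant (+ 0))

  eval-x₀ : (x : ℤ) (c : Vector ℤ d) → eval (+ 1 ◂ constant (+ 0)) (x ∷ᵥ c) ≡ x
  eval-x₀ x c = begin
    eval (+ 1 ◂ constant (+ 0)) (x ∷ᵥ c)  ≡⟨ eval-∷ (+ 1 ◂ constant (+ 0)) x c ⟩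
    + 1 * x + eval (constant (+ 0)) c     ≡⟨ cong₂ _+_ (ℤP.*-identityˡ x) (eval-constant (+ 0) c) ⟩
    x + + 0                               ≡⟨ ℤP.+-identityʳ x ⟩
    x                                     ∎

  -- Completeness for non-negative solutions: descend from y in steps of the period until the
  -- conjunction fails (it must, because of the atom 0 ≤ x₀), then apply eliminate-crossing.
  eliminate-complete : ∀ (C : Conj (Nat.suc d)) c y → + 0 ≤ y →
                       SatConj (x₀-nonneg ∷ C) (y ∷ᵥ c) → Sat (eliminate (x₀-nonneg ∷ C)) c
  eliminate-complete C c y 0≤y hC =
    eliminate-crossing C₀ c (y - + q * + δ) (proj₁ (proj₂ switch))
      (λ h → proj₂ (proj₂ switch) (subst (λ u → SatConj C₀ (u ∷ᵥ c)) (one-more-step y (+ q) (+ δ)) h))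
    where
    C₀ = x₀-nonneg ∷ C
    δ = period C₀
    P : ℕ → Set
    P q = SatConj C₀ ((y - + q * + δ) ∷ᵥ c)
    P₀ : P 0
    P₀ = subst (λ u → SatConj C₀ (u ∷ᵥ c)) (sym (no-step y (+ δ))) hC
      where
      no-step : ∀ y D → y - + 0 * D ≡ y
      no-step = solve-∀
    -- After 1 + y steps of size δ ≥ 1 we are below zero.
    ¬P-end : ¬ P (Nat.suc ∣ y ∣)
    ¬P-end (h ∷ _) =
      ℕP.<⇒≱ (ℕP.<-≤-trans (ℕP.n<1+n ∣ y ∣) (ℕP.m≤m*n (Nat.suc ∣ y ∣) δ {{Nat.>-nonZero (period-pos C₀)}}))
      (ℤP.drop‿+≤+ (subst₂ _≤_ (sym (ℤP.pos-* (Nat.suc ∣ y ∣) δ)) (sym (ℤP.0≤i⇒+∣i∣≡i 0≤y))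
        (ℤP.0≤i-j⇒j≤i (subst (+ 0 ≤_) (eval-x₀ _ c) h))))
    switch = switch-off P (λ q → satConj? C₀ _) P₀ (Nat.suc ∣ y ∣) ¬P-end
    q = proj₁ switch
    one-more-step : ∀ y Q D → y - Q * D - D ≡ y - (+ 1 + Q) * D
    one-more-step = solve-∀

  -- Replacing x₀ by −x₀, so that negative solutions become non-negative ones.
  reflectForm : Form (Nat.suc d) → Form (Nat.suc d)
  reflectForm L = - lead L ◂ rest L

  eval-reflect : (L : Form (Nat.suc d)) (x : ℤ) (c : Vector ℤ d) →
                 eval (reflectForm L) (x ∷ᵥ c) ≡ eval L (- x ∷ᵥ c)
  eval-reflect L x c = begin
    eval (reflectForm L) (x ∷ᵥ c)  ≡⟨ eval-∷ (reflectForm L) x c ⟩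
    - lead L * x + eval (rest L) c ≡⟨ cong (_+ eval (rest L) c) (sym (ℤP.neg-distribˡ-* (lead L) x)) ⟩
    - (lead L * x) + eval (rest L) c ≡⟨ cong (_+ eval (rest L) c) (ℤP.neg-distribʳ-* (lead L) x) ⟩
    lead L * - x + eval (rest L) c ≡⟨ sym (eval-∷ L (- x) c) ⟩
    eval L (- x ∷ᵥ c)              ∎

  reflect : Conj (Nat.suc d) → Conj (Nat.suc d)
  reflect = map (mapAtom reflectForm)

  reflect-correct : ∀ (C : Conj (Nat.suc d)) x c → SatConj (reflect C) (x ∷ᵥ c) ⇔ SatConj C (- x ∷ᵥ c)
  reflect-correct C x c = mk⇔
    (λ h → All.map (λ {A} → Equivalence.to (correct A)) (Allₚ.map⁻ h))
    (λ h → Allₚ.map⁺ (All.map (λ {A} → Equivalence.from (correct A)) h))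
    where
    correct : ∀ A → Holds (mapAtom reflectForm A) (x ∷ᵥ c) ⇔ Holds A (- x ∷ᵥ c)
    correct A = holds-mapAtom reflectForm A (λ L → eval-reflect L x c)

  projectConj : Conj (Nat.suc d) → DNF d
  projectConj C = eliminate (x₀-nonneg ∷ C) ++ eliminate (x₀-nonneg ∷ reflect C)

  project : DNF (Nat.suc d) → DNF d
  project = concatMap projectConj

  projectConj-sound : ∀ (C : Conj (Nat.suc d)) c → Sat (projectConj C) c → ∃[ x ] SatConj C (x ∷ᵥ c)
  projectConj-sound C c h with Anyₚ.++⁻ (eliminate (x₀-nonneg ∷ C)) h
  ... | inj₁ h⁺ = let x , hx = eliminate-sound (x₀-nonneg ∷ C) c h⁺ in x , All.tail hx
  ... | inj₂ h⁻ = let x , hx = eliminate-sound (x₀-nonneg ∷ reflect C) c h⁻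
                  in - x , Equivalence.to (reflect-correct C x c) (All.tail hx)

  projectConj-complete : ∀ (C : Conj (Nat.suc d)) c x → SatConj C (x ∷ᵥ c) → Sat (projectConj C) c
  projectConj-complete C c (+ n) h =
    Anyₚ.++⁺ˡ (eliminate-complete C c (+ n) (+≤+ Nat.z≤n)
                 (subst (+ 0 ≤_) (sym (eval-x₀ (+ n) c)) (+≤+ Nat.z≤n) ∷ h))
  projectConj-complete C c -[1+ n ] h =
    Anyₚ.++⁺ʳ (eliminate (x₀-nonneg ∷ C))
      (eliminate-complete (reflect C) c +[1+ n ] (+≤+ Nat.z≤n)
        (subst (+ 0 ≤_) (sym (eval-x₀ +[1+ n ] c)) (+≤+ Nat.z≤n) ∷ Equivalence.from (reflect-correct C +[1+ n ] c) h))

  project-sound : ∀ (φ : DNF (Nat.suc d)) c → Sat (project φ) c → ∃[ x ] Sat φ (x ∷ᵥ c)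
  project-sound φ c h =
    Anyₚ.Any-Σ⁻ʳ (Any.map (λ {C} → projectConj-sound C c) (Anyₚ.concatMap⁻ projectConj {xs = φ} h))

  project-complete : ∀ (φ : DNF (Nat.suc d)) c x → Sat φ (x ∷ᵥ c) → Sat (project φ) c
  project-complete φ c x h = Anyₚ.concatMap⁺ projectConj (Any.map (λ {C} → projectConj-complete C c x) h)

  satisfiable? : (d : ℕ) (φ : DNF d) → Dec (∃[ c ] Sat φ c)
  satisfiable? Nat.zero φ with sat? φ (λ ())
  ... | yes h = yes ((λ ()) , h)
  ... | no ¬h = no λ (c , h) → ¬h (sat-cong φ (λ ()) h)
  satisfiable? (Nat.suc d) φ with satisfiable? d (project φ)
  ... | yes (c , h) = let x , hx = project-sound φ c h in yes (x ∷ᵥ c , hx)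
  ... | no ¬h = no λ (c , h) → ¬h (tail c , project-complete φ (tail c) (head c)
                                              (sat-cong φ (λ { zero → refl ; (suc i) → refl }) h))

Eventually : (ℕ → Set) → Set
Eventually P = ∃[ N ] (∀ n → N Nat.≤ n → P n)

eventually-∧ : ∀ {P Q : ℕ → Set} → Eventually P → Eventually Q → Eventually (λ n → P n × Q n)
eventually-∧ (N , p) (M , q) =
  N Nat.⊔ M , λ n N⊔M≤n → p n (ℕP.≤-trans (ℕP.m≤m⊔n N M) N⊔M≤n) ,
                          q n (ℕP.≤-trans (ℕP.m≤n⊔m N M) N⊔M≤n)

eventually-map : ∀ {P Q : ℕ → Set} → (∀ n → P n → Q n) → Eventually P → Eventually Q
eventually-map f (N , p) = N , λ n N≤n → f n (p n N≤n)

eventually-∀ : ∀ k {P : Fin k → ℕ → Set} → (∀ i → Eventually (P i)) → Eventually (λ n → ∀ i → P i n)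
eventually-∀ Nat.zero    h = 0 , λ n _ ()
eventually-∀ (Nat.suc k) h = eventually-map (λ n (p₀ , p) → λ { zero → p₀ ; (suc i) → p i })
                               (eventually-∧ (h zero) (eventually-∀ k (h ∘ suc)))

eventually-⇔ : ∀ {P Q : ℕ → Set} → (∀ n → P n ⇔ Q n) → Eventually P ⇔ Eventually Q
eventually-⇔ P⇔Q = mk⇔ (eventually-map (λ n → Equivalence.to (P⇔Q n)))
                       (eventually-map (λ n → Equivalence.from (P⇔Q n)))

threshold⇔ : ∀ {P : ℕ → Set} → (∃[ n₀ ] ((n : ℕ) → n > n₀ → P n)) ⇔ Eventually P
threshold⇔ = mk⇔ (λ (n₀ , p) → Nat.suc n₀ , p) (λ (N , p) → N , λ n N<n → p n (ℕP.<⇒≤ N<n))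

module Growth where

  open Nat using (_+_; _*_; _^_; _∸_; _≤_; _<_; _!; z≤n; s≤s)
  open import Data.Nat.Tactic.RingSolver using (solve-∀)
  open import Relation.Binary.Bundles using (StrictTotalOrder)
  open import Data.Product.Relation.Binary.Lex.Strict using (×-strictTotalOrder)
  open ℕP.≤-Reasoning

  Key : Set
  Key = ℕ × ℕ

  growth : Key → ℕ → ℕ
  growth (p , a) n = n ^ a * Nat.suc p ^ n

  keyOrder : StrictTotalOrder _ _ _
  keyOrder = ×-strictTotalOrder ℕP.<-strictTotalOrder ℕP.<-strictTotalOrder

  open StrictTotalOrder keyOrder public
    using () renaming (_<_ to _≺_; compare to compareKeys; trans to ≺-trans)

  growth-pos : ∀ k n → 1 ≤ n → 1 ≤ growth k n
  growth-pos (p , a) n 1≤n = ℕP.*-mono-≤ (ℕP.m^n>0 n {{Nat.>-nonZero 1≤n}} a) (ℕP.m^n>0 (Nat.suc p) n)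

  -- Binomial coefficients, defined by Pascal's rule (so that proofs can go by induction on it).
  binomial : ℕ → ℕ → ℕ
  binomial n       Nat.zero    = 1
  binomial Nat.zero (Nat.suc m) = 0
  binomial (Nat.suc n) (Nat.suc m) = binomial n m + binomial n (Nat.suc m)

  binomial-absorption : ∀ n m → Nat.suc m * binomial (Nat.suc n) (Nat.suc m) ≡ Nat.suc n * binomial n m
  binomial-absorption Nat.zero    Nat.zero    = refl
  binomial-absorption Nat.zero    (Nat.suc m) = ℕP.*-zeroʳ (2 + m)
  binomial-absorption (Nat.suc n) Nat.zero    = begin-equality
    1 * (1 + binomial (1 + n) 1)  ≡⟨ split (binomial (1 + n) 1) ⟩
    1 + 1 * binomial (1 + n) 1    ≡⟨ cong (1 +_) (binomial-absorption n 0) ⟩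
    1 + (1 + n) * 1               ≡⟨ collect n ⟩
    (2 + n) * 1                   ∎
    where
    split : ∀ x → 1 * (1 + x) ≡ 1 + 1 * x
    split = solve-∀
    collect : ∀ n → 1 + (1 + n) * 1 ≡ (2 + n) * 1
    collect = solve-∀
  binomial-absorption (Nat.suc n) (Nat.suc m) = begin-equality
    (2 + m) * ((binomial n m + binomial n (1 + m)) + binomial (1 + n) (2 + m))
      ≡⟨ expand m (binomial n m) (binomial n (1 + m)) (binomial (1 + n) (2 + m)) ⟩
    (binomial n m + binomial n (1 + m)) + (1 + m) * binomial (1 + n) (1 + m) + (2 + m) * binomial (1 + n) (2 + m)
      ≡⟨ cong₂ (λ u v → (binomial n m + binomial n (1 + m)) + u + v)
               (binomial-absorption n m) (binomial-absorption n (1 + m)) ⟩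
    (binomial n m + binomial n (1 + m)) + (1 + n) * binomial n m + (1 + n) * binomial n (1 + m)
      ≡⟨ collect n (binomial n m) (binomial n (1 + m)) ⟩
    (2 + n) * (binomial n m + binomial n (1 + m)) ∎
    where
    expand : ∀ m a b y → (2 + m) * ((a + b) + y) ≡ (a + b) + (1 + m) * (a + b) + (2 + m) * y
    expand = solve-∀
    collect : ∀ n a b → (a + b) + (1 + n) * a + (1 + n) * b ≡ (2 + n) * (a + b)
    collect = solve-∀

  -- (n − m)^m ≤ m! · C(n, m),  from  m! · C(n, m) = n (n−1) ⋯ (n−m+1).
  binomial-lower-bound : ∀ m n → (n ∸ m) ^ m ≤ m ! * binomial n m
  binomial-lower-bound Nat.zero    n           = ℕP.≤-refl
  binomial-lower-bound (Nat.suc m) Nat.zero    = z≤n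
  binomial-lower-bound (Nat.suc m) (Nat.suc n) = begin
    (n ∸ m) * (n ∸ m) ^ m                     ≤⟨ ℕP.*-mono-≤ (ℕP.≤-trans (ℕP.m∸n≤m n m) (ℕP.n≤1+n n))
                                                                (binomial-lower-bound m n) ⟩
    (1 + n) * (m ! * binomial n m)            ≡⟨ swap (1 + n) (m !) (binomial n m) ⟩
    m ! * ((1 + n) * binomial n m)            ≡⟨ cong (m ! *_) (sym (binomial-absorption n m)) ⟩
    m ! * ((1 + m) * binomial (1 + n) (1 + m)) ≡⟨ swap (m !) (1 + m) _ ⟩
    (1 + m) * (m ! * binomial (1 + n) (1 + m)) ≡⟨ sym (ℕP.*-assoc (1 + m) (m !) _) ⟩
    (1 + m) ! * binomial (1 + n) (1 + m)      ∎
    where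
    swap : ∀ x y z → x * (y * z) ≡ y * (x * z)
    swap = solve-∀

  ^-distribʳ-* : ∀ x y a → (x * y) ^ a ≡ x ^ a * y ^ a
  ^-distribʳ-* x y Nat.zero    = refl
  ^-distribʳ-* x y (Nat.suc a) = trans (cong (x * y *_) (^-distribʳ-* x y a)) (regroup x y (x ^ a) (y ^ a))
    where
    regroup : ∀ x y p q → x * y * (p * q) ≡ x * p * (y * q)
    regroup = solve-∀

  -- A polynomial of degree a is eventually below the binomial coefficient C(n, a + 1).
  -- Writing n = t + (a + 1) with t large:  (a+1)! · K · n^a ≤ (a+1)! · K · 2^a · t^a < t^(a+1).
  polynomial<binomial : ∀ a K → Eventually (λ n → K * n ^ a < binomial n (Nat.suc a))
  polynomial<binomial a K = N , λ n N≤n → ℕP.*-cancelˡ-< (m !) _ _ (bound n N≤n)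
    where
    m  = Nat.suc a
    K′ = K * m !
    N  = Nat.suc (m + K′ * 2 ^ a) + m
    bound : ∀ n → N ≤ n → m ! * (K * n ^ a) < m ! * binomial n m
    bound n N≤n = begin-strict
      m ! * (K * n ^ a)       ≡⟨ regroup (m !) K (n ^ a) ⟩
      K′ * n ^ a              ≡⟨ cong (λ u → K′ * u ^ a) n≡t+m ⟩
      K′ * (t + m) ^ a        ≤⟨ ℕP.*-monoʳ-≤ K′ (ℕP.^-monoˡ-≤ a t+m≤2t) ⟩
      K′ * (2 * t) ^ a        ≡⟨ cong (K′ *_) (^-distribʳ-* 2 t a) ⟩
      K′ * (2 ^ a * t ^ a)    ≡⟨ sym (ℕP.*-assoc K′ (2 ^ a) (t ^ a)) ⟩
      K′ * 2 ^ a * t ^ a      <⟨ ℕP.*-monoˡ-< (t ^ a) {{ℕP.m^n≢0 t a {{Nat.>-nonZero 0<t}}}} K′2ᵃ<t ⟩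
      t * t ^ a               ≤⟨ binomial-lower-bound m n ⟩
      m ! * binomial n m      ∎
      where
      t = n ∸ m
      m≤N : m ≤ N
      m≤N = ℕP.m≤n+m m (Nat.suc (m + K′ * 2 ^ a))
      n≡t+m : n ≡ t + m
      n≡t+m = sym (ℕP.m∸n+n≡m (ℕP.≤-trans m≤N N≤n))
      N-m≤t : Nat.suc (m + K′ * 2 ^ a) ≤ t
      N-m≤t = ℕP.≤-trans (ℕP.≤-reflexive (sym (ℕP.m+n∸n≡m _ m))) (ℕP.∸-monoˡ-≤ m N≤n)
      0<t : 0 < t
      0<t = ℕP.≤-trans (s≤s z≤n) N-m≤t
      t+m≤2t : t + m ≤ 2 * t
      t+m≤2t = begin
        t + m      ≤⟨ ℕP.+-monoʳ-≤ t (ℕP.≤-trans (ℕP.m≤m+n m _) (ℕP.≤-trans (ℕP.n≤1+n _) N-m≤t)) ⟩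
        t + t      ≡⟨ cong (t +_) (sym (ℕP.+-identityʳ t)) ⟩
        2 * t      ∎
      K′2ᵃ<t : K′ * 2 ^ a < t
      K′2ᵃ<t = ℕP.<-≤-trans (s≤s (ℕP.m≤n+m _ m)) N-m≤t
      regroup : ∀ f K x → f * (K * x) ≡ K * f * x
      regroup = solve-∀

  -- One term of the binomial expansion of (1 + b)ⁿ, scaled by b^m:  C(n, m)·bⁿ ≤ (1 + b)ⁿ · b^m.
  binomial-term : ∀ b n m → binomial n m * b ^ n ≤ Nat.suc b ^ n * b ^ m
  binomial-term b Nat.zero    Nat.zero    = ℕP.≤-refl
  binomial-term b Nat.zero    (Nat.suc m) = z≤n
  binomial-term b (Nat.suc n) Nat.zero    = begin
    1 * (b * b ^ n)           ≡⟨ ℕP.*-identityˡ _ ⟩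
    b * b ^ n                 ≤⟨ ℕP.*-mono-≤ (ℕP.n≤1+n b) (subst₂ _≤_ (ℕP.*-identityˡ _) (ℕP.*-identityʳ _)
                                                                    (binomial-term b n 0)) ⟩
    Nat.suc b * Nat.suc b ^ n ≡⟨ sym (ℕP.*-identityʳ _) ⟩
    Nat.suc b * Nat.suc b ^ n * 1 ∎
  binomial-term b (Nat.suc n) (Nat.suc m) = begin
    (binomial n m + binomial n (1 + m)) * (b * b ^ n)
      ≡⟨ distribute (binomial n m) (binomial n (1 + m)) b (b ^ n) ⟩
    b * (binomial n m * b ^ n) + b * (binomial n (1 + m) * b ^ n)
      ≤⟨ ℕP.+-mono-≤ (ℕP.*-monoʳ-≤ b (binomial-term b n m)) (ℕP.*-monoʳ-≤ b (binomial-term b n (1 + m))) ⟩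
    b * (Nat.suc b ^ n * b ^ m) + b * (Nat.suc b ^ n * (b * b ^ m))
      ≡⟨ collect b (Nat.suc b ^ n) (b ^ m) ⟩
    Nat.suc b * Nat.suc b ^ n * (b * b ^ m) ∎
    where
    distribute : ∀ x y b p → (x + y) * (b * p) ≡ b * (x * p) + b * (y * p)
    distribute = solve-∀
    collect : ∀ b s p → b * (s * p) + b * (s * (b * p)) ≡ (1 + b) * s * (b * p)
    collect = solve-∀

  dominates : ∀ k′ k → k′ ≺ k → ∀ K → Eventually (λ n → K * growth k′ n < growth k n)
  dominates (p , a′) (.p , a) (inj₂ (refl , a′<a)) K = Nat.suc K , λ n K<n → begin-strict
    K * (n ^ a′ * B n)      ≡⟨ sym (ℕP.*-assoc K (n ^ a′) (B n)) ⟩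
    K * n ^ a′ * B n        <⟨ ℕP.*-monoˡ-< (B n) {{ℕP.m^n≢0 (Nat.suc p) n}}
                                 (ℕP.*-monoˡ-< (n ^ a′) {{ℕP.m^n≢0 n a′ {{Nat.>-nonZero (0<n K<n)}}}} K<n) ⟩
    n * n ^ a′ * B n        ≤⟨ ℕP.*-monoˡ-≤ (B n) (ℕP.^-monoʳ-≤ n {{Nat.>-nonZero (0<n K<n)}} a′<a) ⟩
    n ^ a * B n             ∎
    where
    B : ℕ → ℕ
    B n = Nat.suc p ^ n
    0<n : ∀ {n} → K < n → 0 < n
    0<n = ℕP.≤-trans (s≤s z≤n)
  dominates (p′ , a′) (p , a) (inj₁ p′<p) K =
    eventually-map bound (eventually-∧ (polynomial<binomial a′ K′) (1 , λ _ 1≤n → 1≤n))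
    where
    b′ = Nat.suc p′
    m  = Nat.suc a′
    K′ = K * b′ ^ m
    bound : ∀ n → K′ * n ^ a′ < binomial n m × 1 ≤ n → K * growth (p′ , a′) n < growth (p , a) n
    bound n (poly<binom , 1≤n) = begin-strict
      K * (n ^ a′ * b′ ^ n)              ≤⟨ ℕP.m≤n*m _ (n ^ a) {{ℕP.m^n≢0 n a {{Nat.>-nonZero 1≤n}}}} ⟩
      n ^ a * (K * (n ^ a′ * b′ ^ n))    <⟨ ℕP.*-monoʳ-< (n ^ a) {{ℕP.m^n≢0 n a {{Nat.>-nonZero 1≤n}}}} below ⟩
      n ^ a * Nat.suc p ^ n              ∎
      where
      scaled : K * (n ^ a′ * b′ ^ n) * b′ ^ m < Nat.suc p ^ n * b′ ^ m
      scaled = begin-strict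
        K * (n ^ a′ * b′ ^ n) * b′ ^ m   ≡⟨ regroup K (n ^ a′) (b′ ^ n) (b′ ^ m) ⟩
        K′ * n ^ a′ * b′ ^ n             <⟨ ℕP.*-monoˡ-< (b′ ^ n) {{ℕP.m^n≢0 b′ n}} poly<binom ⟩
        binomial n m * b′ ^ n            ≤⟨ binomial-term b′ n m ⟩
        Nat.suc b′ ^ n * b′ ^ m          ≤⟨ ℕP.*-monoˡ-≤ (b′ ^ m) (ℕP.^-monoˡ-≤ n (s≤s p′<p)) ⟩
        Nat.suc p ^ n * b′ ^ m           ∎
        where
        regroup : ∀ K x y z → K * (x * y) * z ≡ K * z * x * y
        regroup = solve-∀
      below : K * (n ^ a′ * b′ ^ n) < Nat.suc p ^ n
      below = ℕP.*-cancelʳ-< (b′ ^ m) _ _ scaled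

-- If the keys are strictly decreasing, every term is negligible against the one before it, so
-- the polynomial is eventually positive exactly when its first nonzero coefficient is positive.
module LeadingTerm where

  open Growth
  open Int using (+_; +[1+_]; -[1+_]; _+_; _*_; -_; _≤_; _<_; ∣_∣; +≤+; +<+; -<+; -<-)
  open import Data.List.Relation.Unary.AllPairs using (AllPairs; []; _∷_)
  open import Data.Empty using (⊥)

  Terms : Set → Set
  Terms X = List (Key × X)

  value : Terms ℤ → ℕ → ℤ
  value []            n = + 0
  value ((k , q) ∷ t) n = q * + growth k n + value t n

  magnitude : Terms ℤ → ℕ → ℕ
  magnitude []            n = 0
  magnitude ((k , q) ∷ t) n = ∣ q ∣ Nat.* growth k n Nat.+ magnitude t n

  ∣value∣≤magnitude : ∀ t n → ∣ value t n ∣ Nat.≤ magnitude t n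
  ∣value∣≤magnitude []            n = Nat.z≤n
  ∣value∣≤magnitude ((k , q) ∷ t) n =
    ℕP.≤-trans (ℤP.∣i+j∣≤∣i∣+∣j∣ (q * + growth k n) (value t n))
               (ℕP.+-mono-≤ (ℕP.≤-reflexive (ℤP.abs-* q (+ growth k n))) (∣value∣≤magnitude t n))

  Below : {X : Set} → Key → Terms X → Set
  Below k = All (λ e → proj₁ e ≺ k)

  Sorted : {X : Set} → Terms X → Set
  Sorted = AllPairs (λ e e′ → proj₁ e′ ≺ proj₁ e)

  negligible : ∀ k t → Below k t → ∀ M → Eventually (λ n → M Nat.* magnitude t n Nat.< growth k n)
  negligible k []            []          M =
    1 , λ n 1≤n → subst (Nat._< growth k n) (sym (ℕP.*-zeroʳ M)) (growth-pos k n 1≤n)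
  negligible k ((k′ , q) ∷ t) (k′≺k ∷ below) M =
    eventually-map halves (eventually-∧ (dominates k′ k k′≺k (2 Nat.* M Nat.* ∣ q ∣))
                                        (negligible k t below (2 Nat.* M)))
    where
    open import Data.Nat.Tactic.RingSolver using (solve-∀)
    halves : ∀ n → 2 Nat.* M Nat.* ∣ q ∣ Nat.* growth k′ n Nat.< growth k n ×
                   2 Nat.* M Nat.* magnitude t n Nat.< growth k n →
             M Nat.* magnitude ((k′ , q) ∷ t) n Nat.< growth k n
    halves n (head< , tail<) = ℕP.*-cancelˡ-< 2 _ _
      (subst₂ Nat._<_ (collect M ∣ q ∣ (growth k′ n) (magnitude t n)) (double (growth k n)) (ℕP.+-mono-< head< tail<))
      where
      collect : ∀ M q x y → 2 Nat.* M Nat.* q Nat.* x Nat.+ 2 Nat.* M Nat.* y ≡ 2 Nat.* (M Nat.* (q Nat.* x Nat.+ y))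
      collect = solve-∀
      double : ∀ x → x Nat.+ x ≡ 2 Nat.* x
      double = solve-∀

  ∣x∣<G⇒-G<x : ∀ x G → ∣ x ∣ Nat.< G → - (+ G) < x
  ∣x∣<G⇒-G<x (+ n)    (Nat.suc G) _               = -<+
  ∣x∣<G⇒-G<x -[1+ n ] (Nat.suc G) (Nat.s≤s n<G)  = -<- n<G

  ∣x∣<G⇒x<G : ∀ x G → ∣ x ∣ Nat.< G → x < + G
  ∣x∣<G⇒x<G (+ n)    G           n<G = +<+ n<G
  ∣x∣<G⇒x<G -[1+ n ] (Nat.suc G) _   = -<+

  G≤[1+k]*G : ∀ k G → + G ≤ +[1+ k ] * + G
  G≤[1+k]*G k G = subst (+ G ≤_) (ℤP.pos-* (Nat.suc k) G) (+≤+ (ℕP.m≤m+n G (k Nat.* G)))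

  dominant-positive : ∀ k G x → ∣ x ∣ Nat.< G → + 0 < +[1+ k ] * + G + x
  dominant-positive k G x ∣x∣<G = ℤP.<-≤-trans 0<G+x (ℤP.+-monoˡ-≤ x (G≤[1+k]*G k G))
    where
    0<G+x : + 0 < + G + x
    0<G+x = subst (_< + G + x) (ℤP.+-inverseʳ (+ G)) (ℤP.+-monoʳ-< (+ G) (∣x∣<G⇒-G<x x G ∣x∣<G))

  dominant-negative : ∀ k G x → ∣ x ∣ Nat.< G → -[1+ k ] * + G + x < + 0
  dominant-negative k G x ∣x∣<G = ℤP.≤-<-trans (ℤP.+-monoˡ-≤ x -[1+k]*G≤-G) -G+x<0
    where
    -[1+k]*G≤-G : -[1+ k ] * + G ≤ - (+ G)
    -[1+k]*G≤-G = subst (_≤ - (+ G)) (ℤP.neg-distribˡ-* +[1+ k ] (+ G)) (ℤP.neg-mono-≤ (G≤[1+k]*G k G))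
    -G+x<0 : - (+ G) + x < + 0
    -G+x<0 = subst (- (+ G) + x <_) (ℤP.+-inverseˡ (+ G)) (ℤP.+-monoʳ-< (- (+ G)) (∣x∣<G⇒x<G x G ∣x∣<G))

  EventuallyPositive : (ℕ → ℤ) → Set
  EventuallyPositive f = Eventually (λ n → + 0 < f n)

  LeadingPositive : Terms ℤ → Set
  LeadingPositive []            = ⊥
  LeadingPositive ((k , q) ∷ t) = + 0 < q ⊎ (q ≡ + 0 × LeadingPositive t)

  leading-sign : ∀ t → Sorted t → EventuallyPositive (value t) ⇔ LeadingPositive t
  leading-sign [] _ = mk⇔ (λ (N , pos) → ℤP.<-irrefl refl (pos N ℕP.≤-refl)) λ ()
  leading-sign ((k , +[1+ j ]) ∷ t) (below ∷ _) = mk⇔ (λ _ → inj₁ (+<+ (Nat.s≤s Nat.z≤n))) λ _ →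
    eventually-map (λ n rest< → dominant-positive j (growth k n) (value t n) (rest-small n rest<))
                   (negligible k t below 1)
    where
    rest-small : ∀ n → 1 Nat.* magnitude t n Nat.< growth k n → ∣ value t n ∣ Nat.< growth k n
    rest-small n rest< = ℕP.≤-<-trans (∣value∣≤magnitude t n) (subst (Nat._< _) (ℕP.*-identityˡ _) rest<)
  leading-sign ((k , -[1+ j ]) ∷ t) (below ∷ _) = mk⇔ contradiction λ { (inj₁ ()) ; (inj₂ (() , _)) }
    where
    contradiction : EventuallyPositive (value ((k , -[1+ j ]) ∷ t)) → LeadingPositive ((k , -[1+ j ]) ∷ t)
    contradiction pos with eventually-∧ pos (negligible k t below 1)
    ... | N , both with both N ℕP.≤-refl
    ... | 0<v , rest< = ⊥-elim (ℤP.<-asym 0<v (dominant-negative j (growth k N) (value t N)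
                          (ℕP.≤-<-trans (∣value∣≤magnitude t N) (subst (Nat._< _) (ℕP.*-identityˡ _) rest<))))
  leading-sign ((k , + 0) ∷ t) (_ ∷ sorted) = mk⇔
    (λ pos → inj₂ (refl , Equivalence.to (leading-sign t sorted) (eventually-map (λ n → subst (+ 0 <_) (drop n)) pos)))
    (λ { (inj₁ (+<+ ())) ; (inj₂ (_ , lead)) →
         eventually-map (λ n → subst (+ 0 <_) (sym (drop n))) (Equivalence.from (leading-sign t sorted) lead) })
    where
    drop : ∀ n → + 0 * + growth k n + value t n ≡ value t n
    drop n = ℤP.+-identityˡ (value t n)

module Normalisation where

  open IntegerForms
  open Growth
  open LeadingTerm
  open Int using (_+_; _*_; +_)
  open import Data.Integer.Tactic.RingSolver using (solve-∀)
  open import Data.List using (foldr)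
  open import Data.List.Relation.Unary.AllPairs using ([]; _∷_)
  open import Relation.Binary.Definitions using (tri<; tri≈; tri>)
  import Data.Product as Product

  instantiate : Vector ℤ d → Terms (Form d) → Terms ℤ
  instantiate c = map (Product.map₂ (λ L → eval L c))

  instantiate-sorted : (c : Vector ℤ d) (t : Terms (Form d)) → Sorted t → Sorted (instantiate c t)
  instantiate-sorted c t = AllPairsₚ.map⁺
    where import Data.List.Relation.Unary.AllPairs.Properties as AllPairsₚ

  insert : Key × Form d → Terms (Form d) → Terms (Form d)
  insert e [] = e ∷ []
  insert (k , L) ((k′ , L′) ∷ t) with compareKeys k k′
  ... | tri< _ _ _ = (k′ , L′) ∷ insert (k , L) t
  ... | tri≈ _ _ _ = (k′ , L ⊕ L′) ∷ t
  ... | tri> _ _ _ = (k , L) ∷ (k′ , L′) ∷ t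

  insert-below : ∀ K (e : Key × Form d) t → proj₁ e ≺ K → Below K t → Below K (insert e t)
  insert-below K e [] e≺K [] = e≺K ∷ []
  insert-below K (k , L) ((k′ , L′) ∷ t) k≺K (k′≺K ∷ below) with compareKeys k k′
  ... | tri< _ _ _ = k′≺K ∷ insert-below K (k , L) t k≺K below
  ... | tri≈ _ _ _ = k′≺K ∷ below
  ... | tri> _ _ _ = k≺K ∷ k′≺K ∷ below

  insert-sorted : ∀ (e : Key × Form d) t → Sorted t → Sorted (insert e t)
  insert-sorted e [] [] = [] ∷ []
  insert-sorted (k , L) ((k′ , L′) ∷ t) (below ∷ sorted) with compareKeys k k′
  ... | tri< k≺k′ _ _ = insert-below k′ (k , L) t k≺k′ below ∷ insert-sorted (k , L) t sorted
  ... | tri≈ _ _ _    = below ∷ sorted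
  ... | tri> _ _ k′≺k = (k′≺k ∷ All.map (λ k″≺k′ → ≺-trans k″≺k′ k′≺k) below) ∷ below ∷ sorted

  insert-value : ∀ (e : Key × Form d) t c n →
                 value (instantiate c (insert e t)) n ≡ value (instantiate c (e ∷ t)) n
  insert-value e [] c n = refl
  insert-value (k , L) ((k′ , L′) ∷ t) c n with compareKeys k k′
  ... | tri< _ _ _ = trans (cong (λ u → eval L′ c * + growth k′ n + u) (insert-value (k , L) t c n))
                           (swap (eval L′ c * + growth k′ n) (eval L c * + growth k n) (value (instantiate c t) n))
    where
    swap : ∀ x y z → x + (y + z) ≡ y + (x + z)
    swap = solve-∀
  ... | tri≈ _ (refl , refl) _ =
    trans (cong (λ u → u * + growth k n + value (instantiate c t) n) (eval-⊕ L L′ c))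
          (distribute (eval L c) (eval L′ c) (+ growth k n) (value (instantiate c t) n))
    where
    distribute : ∀ x y G z → (x + y) * G + z ≡ x * G + (y * G + z)
    distribute = solve-∀
  ... | tri> _ _ _ = refl

  normalise : Terms (Form d) → Terms (Form d)
  normalise = foldr insert []

  normalise-sorted : (t : Terms (Form d)) → Sorted (normalise t)
  normalise-sorted []      = []
  normalise-sorted (e ∷ t) = insert-sorted e (normalise t) (normalise-sorted t)

  normalise-value : ∀ (t : Terms (Form d)) c n → value (instantiate c (normalise t)) n ≡ value (instantiate c t) n
  normalise-value []            c n = refl
  normalise-value ((k , L) ∷ t) c n =
    trans (insert-value (k , L) (normalise t) c n) (cong (λ u → eval L c * + growth k n + u) (normalise-value t c n))

module LeadingFormula where

  open IntegerForms
  open Formulas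
  open LeadingTerm
  open Normalisation
  open Int using (+_; +[1+_]; -[1+_]; _+_; -_; _≤_; _<_; +≤+; +<+; -1ℤ)

  positive⇔ : ∀ v → (+ 0 < v) ⇔ (+ 0 ≤ v + -1ℤ)
  positive⇔ (+ 0)      = mk⇔ (λ { (+<+ ()) }) (λ ())
  positive⇔ +[1+ n ]   = mk⇔ (λ _ → +≤+ Nat.z≤n) (λ _ → +<+ (Nat.s≤s Nat.z≤n))
  positive⇔ -[1+ n ]   = mk⇔ (λ ()) (λ ())

  zero⇔ : ∀ v → (v ≡ + 0) ⇔ (+ 0 ≤ v × + 0 ≤ - v)
  zero⇔ (+ 0)      = mk⇔ (λ _ → +≤+ Nat.z≤n , +≤+ Nat.z≤n) (λ _ → refl)
  zero⇔ +[1+ n ]   = mk⇔ (λ ()) (λ ())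
  zero⇔ -[1+ n ]   = mk⇔ (λ ()) (λ ())

  isPositive : Form d → Atom d
  isPositive L = nonneg (L ⊕ constant -1ℤ)

  isZero : Form d → Conj d
  isZero L = nonneg L ∷ nonneg (-1ℤ ⊛ L) ∷ []

  isPositive-correct : ∀ (L : Form d) c → Holds (isPositive L) c ⇔ (+ 0 < eval L c)
  isPositive-correct L c =
    subst (λ u → (+ 0 ≤ u) ⇔ (+ 0 < eval L c))
          (sym (trans (eval-⊕ L (constant -1ℤ) c) (cong (λ u → eval L c + u) (eval-constant -1ℤ c))))
          (⇔.sym (positive⇔ (eval L c)))

  isZero-correct : ∀ (L : Form d) c → SatConj (isZero L) c ⇔ (eval L c ≡ + 0)
  isZero-correct L c = mk⇔
    (λ { (0≤v ∷ 0≤-v ∷ []) → Equivalence.from (zero⇔ (eval L c)) (0≤v , subst (+ 0 ≤_) negate 0≤-v) })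
    (λ v≡0 → let 0≤v , 0≤-v = Equivalence.to (zero⇔ (eval L c)) v≡0 in
             0≤v ∷ subst (+ 0 ≤_) (sym negate) 0≤-v ∷ [])
    where
    negate : eval (-1ℤ ⊛ L) c ≡ - eval L c
    negate = trans (eval-⊛ -1ℤ L c) (ℤP.-1*i≡-i (eval L c))

  leadingPositive : Terms (Form d) → DNF d
  leadingPositive []            = []
  leadingPositive ((k , L) ∷ t) = (isPositive L ∷ []) ∷ ((isZero L ∷ []) ∧ leadingPositive t)

  leadingPositive-correct : ∀ (t : Terms (Form d)) c → Sat (leadingPositive t) c ⇔ LeadingPositive (instantiate c t)
  leadingPositive-correct []            c = mk⇔ (λ ()) (λ ())
  leadingPositive-correct ((k , L) ∷ t) c = mk⇔ to from
    where
    IH = leadingPositive-correct t c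
    to : Sat (leadingPositive ((k , L) ∷ t)) c → LeadingPositive (instantiate c ((k , L) ∷ t))
    to (here (pos ∷ [])) = inj₁ (Equivalence.to (isPositive-correct L c) pos)
    to (there h) with ∧-elim (isZero L ∷ []) (leadingPositive t) h
    ... | here vanishes , rest = inj₂ (Equivalence.to (isZero-correct L c) vanishes , Equivalence.to IH rest)
    from : LeadingPositive (instantiate c ((k , L) ∷ t)) → Sat (leadingPositive ((k , L) ∷ t)) c
    from (inj₁ pos)         = here (Equivalence.from (isPositive-correct L c) pos ∷ [])
    from (inj₂ (vanishes , lead)) =
      there (∧-intro (isZero L ∷ []) (leadingPositive t) (here (Equivalence.from (isZero-correct L c) vanishes))
                     (Equivalence.from IH lead))

-- Clearing denominators: the rational data of the problem is represented exactly by integer data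
-- over a positive denominator, which does not affect signs.
module ClearingDenominators where

  open IntegerForms
  open Growth using (Key; growth)
  open LeadingTerm using (Terms; value)
  open Normalisation using (instantiate)
  open Int using (+_; +[1+_]; _+_; _*_; _<_)
  open import Data.Integer.Tactic.RingSolver using (solve-∀)
  import Data.Rational as Rat
  import Data.Rational.Properties as RatP
  open import Data.Rational.Unnormalised using (mkℚᵘ; _≃_; *<*)
  import Data.Rational.Unnormalised.Properties as RatᵘP
  import Data.Product as Product

  infix 4 _≐_∕1+_

  _≐_∕1+_ : ℚ → ℤ → ℕ → Set
  q ≐ z ∕1+ p = Rat.toℚᵘ q ≃ mkℚᵘ z p

  -- The denominators multiply:  (1 + p)(1 + s) = 1 + p ⊗ s.
  _⊗_ : ℕ → ℕ → ℕ
  p ⊗ s = s Nat.+ p Nat.* Nat.suc s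

  ≐-canonical : (v : ℚ) → v ≐ ℚ.numerator v ∕1+ ℚ.denominator-1 v
  ≐-canonical (Rat.mkℚ _ _ _) = RatᵘP.≃-refl

  ≐-ℤ : (z : ℤ) → ℤ→ℚ z ≐ z ∕1+ 0
  ≐-ℤ z = RatP.toℚᵘ-fromℚᵘ (mkℚᵘ z 0)

  ≐-ℕ : (m : ℕ) → ℕ→ℚ m ≐ + m ∕1+ 0
  ≐-ℕ m = ≐-ℤ (+ m)

  ≐-+ : ∀ {q r z w p s} → q ≐ z ∕1+ p → r ≐ w ∕1+ s →
        q Rat.+ r ≐ z * +[1+ s ] + w * +[1+ p ] ∕1+ p ⊗ s
  ≐-+ {q} {r} q≐ r≐ = RatᵘP.≃-trans (RatP.toℚᵘ-homo-+ q r) (RatᵘP.+-cong q≐ r≐)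

  ≐-* : ∀ {q r z w p s} → q ≐ z ∕1+ p → r ≐ w ∕1+ s → q Rat.* r ≐ z * w ∕1+ p ⊗ s
  ≐-* {q} {r} q≐ r≐ = RatᵘP.≃-trans (RatP.toℚᵘ-homo-* q r) (RatᵘP.*-cong q≐ r≐)

  ≐-num : ∀ {q z z′ p} → z ≡ z′ → q ≐ z ∕1+ p → q ≐ z′ ∕1+ p
  ≐-num refl q≐ = q≐

  ≐-positive : ∀ {q z p} → q ≐ z ∕1+ p → (0ℚ <ℚ q) ⇔ (+ 0 < z)
  ≐-positive {q} {z} q≐ = mk⇔ to from
    where
    to : 0ℚ <ℚ q → + 0 < z
    to 0<q with RatᵘP.<-respʳ-≃ q≐ (RatP.toℚᵘ-mono-< 0<q)
    ... | *<* 0<z*1 = subst (+ 0 <_) (ℤP.*-identityʳ z) 0<z*1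
    from : + 0 < z → 0ℚ <ℚ q
    from 0<z = RatP.toℚᵘ-cancel-<
      (RatᵘP.<-respʳ-≃ (RatᵘP.≃-sym q≐) (*<* (subst (+ 0 <_) (sym (ℤP.*-identityʳ z)) 0<z)))

  clearSum : (d : ℕ) → (Fin d → ℚ) → Form d × ℕ
  clearSum Nat.zero    v = form (λ ()) (+ 0) , 0
  clearSum (Nat.suc d) v = ℚ.numerator (v zero) * +[1+ p ] ◂ +[1+ s ] ⊛ L , s ⊗ p
    where
    L = proj₁ (clearSum d (tail v))
    p = proj₂ (clearSum d (tail v))
    s = ℚ.denominator-1 (v zero) ⊗ 0

  clearSum-correct : ∀ d (v : Fin d → ℚ) (c : Vector ℤ d) →
                     sumFin d (λ i → v i Rat.* ℤ→ℚ (c i)) ≐ eval (proj₁ (clearSum d v)) c ∕1+ proj₂ (clearSum d v)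
  clearSum-correct Nat.zero    v c = RatᵘP.≃-refl
  clearSum-correct (Nat.suc d) v c =
    ≐-num value≡ (≐-+ (≐-* (≐-canonical (v zero)) (≐-ℤ (c zero))) (clearSum-correct d (tail v) (tail c)))
    where
    L = proj₁ (clearSum d (tail v))
    p = proj₂ (clearSum d (tail v))
    s = ℚ.denominator-1 (v zero) ⊗ 0
    n₀ = ℚ.numerator (v zero)
    value≡ : n₀ * c zero * +[1+ p ] + eval L (tail c) * +[1+ s ] ≡ eval (n₀ * +[1+ p ] ◂ +[1+ s ] ⊛ L) c
    value≡ = begin
      n₀ * c zero * +[1+ p ] + eval L (tail c) * +[1+ s ]
        ≡⟨ regroup n₀ (c zero) +[1+ p ] (eval L (tail c)) +[1+ s ] ⟩
      n₀ * +[1+ p ] * c zero + +[1+ s ] * eval L (tail c)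
        ≡⟨ cong (λ u → n₀ * +[1+ p ] * c zero + u) (sym (eval-⊛ +[1+ s ] L (tail c))) ⟩
      n₀ * +[1+ p ] * c zero + eval (+[1+ s ] ⊛ L) (tail c)
        ≡⟨ sym (eval-∷ (n₀ * +[1+ p ] ◂ +[1+ s ] ⊛ L) (c zero) (tail c)) ⟩
      eval (n₀ * +[1+ p ] ◂ +[1+ s ] ⊛ L) c ∎
      where
      open ≡-Reasoning
      regroup : ∀ n x P y S → n * x * P + y * S ≡ n * P * x + S * y
      regroup = solve-∀

  clearAffine : Affine d → Form d × ℕ
  clearAffine {d} (affine v v₀) = +[1+ e ] ⊛ L ⊕ constant (ℚ.numerator v₀ * +[1+ p ]) , p ⊗ e
    where
    L = proj₁ (clearSum d v)
    p = proj₂ (clearSum d v)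
    e = ℚ.denominator-1 v₀

  clearAffine-correct : ∀ (α : Affine d) c →
                        evalAffine α c ≐ eval (proj₁ (clearAffine α)) c ∕1+ proj₂ (clearAffine α)
  clearAffine-correct {d} (affine v v₀) c = ≐-num value≡ (≐-+ (clearSum-correct d v c) (≐-canonical v₀))
    where
    L = proj₁ (clearSum d v)
    p = proj₂ (clearSum d v)
    e = ℚ.denominator-1 v₀
    m₀ = ℚ.numerator v₀
    value≡ : eval L c * +[1+ e ] + m₀ * +[1+ p ] ≡ eval (+[1+ e ] ⊛ L ⊕ constant (m₀ * +[1+ p ])) c
    value≡ = sym (begin
      eval (+[1+ e ] ⊛ L ⊕ constant (m₀ * +[1+ p ])) c
        ≡⟨ eval-⊕ (+[1+ e ] ⊛ L) (constant (m₀ * +[1+ p ])) c ⟩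
      eval (+[1+ e ] ⊛ L) c + eval (constant (m₀ * +[1+ p ])) c
        ≡⟨ cong₂ _+_ (trans (eval-⊛ +[1+ e ] L c) (ℤP.*-comm +[1+ e ] (eval L c)))
                     (eval-constant (m₀ * +[1+ p ]) c) ⟩
      eval L c * +[1+ e ] + m₀ * +[1+ p ] ∎)
      where open ≡-Reasoning

  scaleTerms : ℤ → Terms (Form d) → Terms (Form d)
  scaleTerms k = map (Product.map₂ (k ⊛_))

  scaleTerms-value : ∀ k (t : Terms (Form d)) c n →
                     value (instantiate c (scaleTerms k t)) n ≡ k * value (instantiate c t) n
  scaleTerms-value k []            c n = sym (ℤP.*-zeroʳ k)
  scaleTerms-value k ((κ , L) ∷ t) c n =
    trans (cong₂ (λ u w → u * + growth κ n + w) (eval-⊛ k L c) (scaleTerms-value k t c n))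
          (factor k (eval L c) (+ growth κ n) (value (instantiate c t) n))
    where
    factor : ∀ k x G y → k * x * G + k * y ≡ k * (x * G + y)
    factor = solve-∀

  clearNPE : NPE d → Terms (Form d) × ℕ
  clearNPE []                                  = [] , 0
  clearNPE (npeTerm α a Nat.zero () ∷ p)
  clearNPE (npeTerm α a (Nat.suc b) _ ∷ p) =
    ((b , a) , +[1+ s ] ⊛ L) ∷ scaleTerms +[1+ e ] t , e ⊗ s
    where
    L = proj₁ (clearAffine α)
    e = (proj₂ (clearAffine α) ⊗ 0) ⊗ 0
    t = proj₁ (clearNPE p)
    s = proj₂ (clearNPE p)

  clearNPE-correct : ∀ (p : NPE d) c n →
                     evalNPE p c n ≐ value (instantiate c (proj₁ (clearNPE p))) n ∕1+ proj₂ (clearNPE p)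
  clearNPE-correct []                                  c n = RatᵘP.≃-refl
  clearNPE-correct (npeTerm α a Nat.zero () ∷ p)      c n
  clearNPE-correct (npeTerm α a (Nat.suc b) b≥1 ∷ p) c n =
    ≐-num value≡ (≐-+ (≐-* (≐-* (clearAffine-correct α c) (≐-ℕ (n Nat.^ a))) (≐-ℕ (Nat.suc b Nat.^ n)))
                      (clearNPE-correct p c n))
    where
    L = proj₁ (clearAffine α)
    e = (proj₂ (clearAffine α) ⊗ 0) ⊗ 0
    t = proj₁ (clearNPE p)
    s = proj₂ (clearNPE p)
    X = eval L c
    Y = value (instantiate c t) n
    value≡ : X * + (n Nat.^ a) * + (Nat.suc b Nat.^ n) * +[1+ s ] + Y * +[1+ e ] ≡
             eval (+[1+ s ] ⊛ L) c * + growth (b , a) n + value (instantiate c (scaleTerms +[1+ e ] t)) n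
    value≡ = sym (begin
      eval (+[1+ s ] ⊛ L) c * + growth (b , a) n + value (instantiate c (scaleTerms +[1+ e ] t)) n
        ≡⟨ cong₂ (λ u w → u * + growth (b , a) n + w) (eval-⊛ +[1+ s ] L c) (scaleTerms-value +[1+ e ] t c n) ⟩
      +[1+ s ] * X * + (n Nat.^ a Nat.* Nat.suc b Nat.^ n) + +[1+ e ] * Y
        ≡⟨ cong (λ u → +[1+ s ] * X * u + +[1+ e ] * Y) (ℤP.pos-* (n Nat.^ a) (Nat.suc b Nat.^ n)) ⟩
      +[1+ s ] * X * (+ (n Nat.^ a) * + (Nat.suc b Nat.^ n)) + +[1+ e ] * Y
        ≡⟨ regroup +[1+ s ] X (+ (n Nat.^ a)) (+ (Nat.suc b Nat.^ n)) +[1+ e ] Y ⟩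
      X * + (n Nat.^ a) * + (Nat.suc b Nat.^ n) * +[1+ s ] + Y * +[1+ e ] ∎)
      where
      open ≡-Reasoning
      regroup : ∀ S x u w E y → S * x * (u * w) + E * y ≡ x * u * w * S + y * E
      regroup = solve-∀

module Reduction (d k : ℕ) (p : Fin k → NPE d) where

  open IntegerForms
  open Formulas
  open LeadingTerm
  open Normalisation
  open LeadingFormula
  open ClearingDenominators

  terms : Fin k → Terms (Form d)
  terms i = normalise (proj₁ (clearNPE (p i)))

  formula : DNF d
  formula = ⋀ k (λ i → leadingPositive (terms i))

  eventually-positive⇔ : ∀ i c →
                         Eventually (λ n → 0ℚ <ℚ evalNPE (p i) c n) ⇔ Sat (leadingPositive (terms i)) c
  eventually-positive⇔ i c = ⇔.trans (eventually-⇔ integral)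
    (⇔.trans (leading-sign (instantiate c (terms i)) (instantiate-sorted c (terms i) (normalise-sorted t)))
             (⇔.sym (leadingPositive-correct (terms i) c)))
    where
    t = proj₁ (clearNPE (p i))
    integral : ∀ n → (0ℚ <ℚ evalNPE (p i) c n) ⇔ (Int.+ 0 Int.< value (instantiate c (terms i)) n)
    integral n = subst (λ v → (0ℚ <ℚ evalNPE (p i) c n) ⇔ (Int.+ 0 Int.< v)) (sym (normalise-value t c n))
                       (≐-positive (clearNPE-correct (p i) c n))

  formula-correct : ∀ c →
                    Sat formula c ⇔ (∃[ n₀ ] ((n : ℕ) → n > n₀ → (i : Fin k) → 0ℚ <ℚ evalNPE (p i) c n))
  formula-correct c = mk⇔
    (λ sat → Equivalence.from threshold⇔
               (eventually-∀ k (λ i → Equivalence.from (eventually-positive⇔ i c) (⋀-elim k _ sat i))))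
    (λ pos → ⋀-intro k _ (λ i → Equivalence.to (eventually-positive⇔ i c)
               (eventually-map (λ n all → all i) (Equivalence.to threshold⇔ pos))))

lemma10 : (d k : ℕ) (p : Fin k → NPE d) →
          Dec (∃[ c ] ∃[ n₀ ] ((n : ℕ) → n > n₀ → (i : Fin k) →
                0ℚ <ℚ evalNPE (p i) c n))
lemma10 d k p = Dec.map (mk⇔ (λ (c , sat) → c , Equivalence.to (formula-correct c) sat)
                              (λ (c , pos) → c , Equivalence.from (formula-correct c) pos))
                        (Elimination.satisfiable? d formula)
  where
  open Reduction d k p
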